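{- Let $(X,d)$ be a metric space, $\emptyset\neq F\subseteq X$ with representation $(\tilde F_k)$ and associated sets $AF_k$, and let $(x_n)$ be a Cauchy sequence in $X$ with a selfmajorizing rate of metastability $\Psi$ (for the Cauchy property). Let $k\in\mathbb{N}$ and $g:\mathbb{N}\to\mathbb{N}$. (i) If $(x_n)$ is asymptotically regular w.r.t. $F$ with a selfmajorizing rate of metastability $\Phi^+$ for the asymptotic regularity, then there is $N\le\Omega_{k,g}(\Psi,\Phi^+)$ such that for all $i,j\in[N,N+g(N)]$: $d(x_i,x_j)\le\frac1{k+1}$ and $x_i\in AF_k$. (ii) If $(x_n)$ is asymptotically regular w.r.t. $F$ with a rate of asymptotic regularity $\Phi^{++}$, then there is $N\le\tilde\Omega_{k,g}(\Psi,(\Phi^{++})^M)$ such that for all $i,j\in[N,N+g(N)]$ and all $m\ge N$: $d(x_i,x_j)\le\frac1{k+1}$ and $x_m\in AF_k$.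
   Context: Representation: $F=\bigcap_k\tilde F_k$, $AF_k:=\bigcap_{l\le k}\tilde F_l$. For $f:\mathbb{N}\to\mathbb{N}$, $f^M(n):=\max\{f(i)\mid i\le n\}$. For $f,f^*:\mathbb{N}\to\mathbb{N}$, $f^*\gtrsim f$ means: for all $n^*\ge n$, $f^*(n^*)\ge f^*(n)$ and $f^*(n^*)\ge f(n)$. For $\Phi,\Phi^*:\mathbb{N}\times\mathbb{N}^{\mathbb{N}}\to\mathbb{N}$, $\Phi^*\gtrsim\Phi$ means: for all $k'\ge k$ and $g'\gtrsim g$, $\Phi^*(k',g')\ge\Phi^*(k,g)$ and $\Phi^*(k',g')\ge\Phi(k,g)$; $\Phi$ is selfmajorizing if $\Phi\gtrsim\Phi$. A rate of metastability for the Cauchy property is $\Psi:\mathbb{N}\times\mathbb{N}^{\mathbb{N}}\to\mathbb{N}$ with: for all $k,g$ there is $N\le\Psi(k,g)$ with $d(x_i,x_j)\le\frac1{k+1}$ for all $i,j\in[N,N+g(N)]$. $(x_n)$ is asymptotically regular w.r.t. $F$ if for all $k$ there is $N$ with $x_m\in AF_k$ for all $m\ge N$. A rate of metastability for asymptotic regularity is $\Phi^+:\mathbb{N}\times\mathbb{N}^{\mathbb{N}}\to\mathbb{N}$ with: for all $k,g$ there is $N\le\Phi^+(k,g)$ with $x_m\in AF_k$ for all $m\in[N,N+g(N)]$. A rate of asymptotic regularity is $\Phi^{++}:\mathbb{N}\to\mathbb{N}$ with $x_n\in AF_k$ for all $k$ and all $n\ge\Phi^{++}(k)$. Given $k,g$: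 $g^*(n):=n+g^M(n)$; $\tilde g_l(m):=g^*(\max\{l,m\})$; for $\delta:\mathbb{N}\times\mathbb{N}^{\mathbb{N}}\to\mathbb{N}$, $h_{k,g,\delta}(n):=g^*(\max\{n,\delta(k,\tilde g_n)\})$; $\Omega_{k,g}(\delta,\theta):=\max\{\delta(k,h_{k,g,\theta}),\ \theta(k,\tilde g_{\delta(k,h_{k,g,\theta})})\}$; $g_l(n):=g^M(n+l)+l$; for $f:\mathbb{N}\to\mathbb{N}$, $\tilde\Omega_{k,g}(\delta,f):=\delta(k,g_{f(k)})+f(k)$. -}

module Defs where

open import Data.Nat using (ℕ; zero; suc; _+_; _≤_; _⊔_)
open import Data.Product using (_×_; Σ; ∃)

_ᴹ : (ℕ → ℕ) → ℕ → ℕ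
(f ᴹ) zero    = f zero
(f ᴹ) (suc n) = (f ᴹ) n ⊔ f (suc n)

_≳_ : (ℕ → ℕ) → (ℕ → ℕ) → Set
f* ≳ f = ∀ n n* → n ≤ n* → (f* n ≤ f* n*) × (f n ≤ f* n*)

_≳ᶠ_ : (ℕ → (ℕ → ℕ) → ℕ) → (ℕ → (ℕ → ℕ) → ℕ) → Set
Φ* ≳ᶠ Φ = ∀ k k' (g g' : ℕ → ℕ) → k ≤ k' → g' ≳ g →
          (Φ* k g ≤ Φ* k' g') × (Φ k g ≤ Φ* k' g')

Selfmajorizing : (ℕ → (ℕ → ℕ) → ℕ) → Set
Selfmajorizing Φ = Φ ≳ᶠ Φ

AF : {X : Set} → (ℕ → X → Set) → ℕ → X → Set
AF Ft k x = ∀ l → l ≤ k → Ft l x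

InF : {X : Set} → (ℕ → X → Set) → X → Set
InF Ft x = ∀ k → Ft k x

_∈[_,_] : ℕ → ℕ → ℕ → Set
i ∈[ a , b ] = (a ≤ i) × (i ≤ b)

-- The metric enters only through the relations "d(x,y) ≤ 1/(k+1)",
-- abstracted as Close k x y.

IsCauchy : {X : Set} → (ℕ → X → X → Set) → (ℕ → X) → Set
IsCauchy Close x = ∀ k → Σ ℕ λ N → ∀ i j → N ≤ i → N ≤ j → Close k (x i) (x j)

CauchyMetastabRate : {X : Set} → (ℕ → X → X → Set) → (ℕ → X) →
                     (ℕ → (ℕ → ℕ) → ℕ) → Set
CauchyMetastabRate Close x Ψ = ∀ k (g : ℕ → ℕ) → Σ ℕ λ N → (N ≤ Ψ k g) ×
  (∀ i j → i ∈[ N , N + g N ] → j ∈[ N , N + g N ] → Close k (x i) (x j))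

AsympReg : {X : Set} → (ℕ → X → Set) → (ℕ → X) → Set
AsympReg Ft x = ∀ k → Σ ℕ λ N → ∀ m → N ≤ m → AF Ft k (x m)

ARMetastabRate : {X : Set} → (ℕ → X → Set) → (ℕ → X) →
                 (ℕ → (ℕ → ℕ) → ℕ) → Set
ARMetastabRate Ft x Φ = ∀ k (g : ℕ → ℕ) → Σ ℕ λ N → (N ≤ Φ k g) ×
  (∀ m → m ∈[ N , N + g N ] → AF Ft k (x m))

ARRate : {X : Set} → (ℕ → X → Set) → (ℕ → X) → (ℕ → ℕ) → Set
ARRate Ft x Φ = ∀ k n → Φ k ≤ n → AF Ft k (x n)

gstar : (ℕ → ℕ) → ℕ → ℕ
gstar g n = n + (g ᴹ) n

gtilde : (ℕ → ℕ) → ℕ → ℕ → ℕ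
gtilde g l m = gstar g (l ⊔ m)

hfun : ℕ → (ℕ → ℕ) → (ℕ → (ℕ → ℕ) → ℕ) → ℕ → ℕ
hfun k g δ n = gstar g (n ⊔ δ k (gtilde g n))

Ω : ℕ → (ℕ → ℕ) → (ℕ → (ℕ → ℕ) → ℕ) → (ℕ → (ℕ → ℕ) → ℕ) → ℕ
Ω k g δ θ = δ k (hfun k g θ) ⊔ θ k (gtilde g (δ k (hfun k g θ)))

gsub : (ℕ → ℕ) → ℕ → ℕ → ℕ
gsub g l n = (g ᴹ) (n + l) + l

Ω̃ : ℕ → (ℕ → ℕ) → (ℕ → (ℕ → ℕ) → ℕ) → (ℕ → ℕ) → ℕ
Ω̃ k g δ f = δ k (gsub g (f k)) + f k

module Submission where

-- (i) Apply the Cauchy rate Ψ to the counterfunction h = h_{k,g,Φ⁺}, getting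
--     N₀ ≤ Ψ(k,h) whose window [N₀, N₀ + h(N₀)] is k-close; then apply the
--     regularity rate Φ⁺ to g̃_{N₀}, getting N₁ ≤ Φ⁺(k,g̃_{N₀}) whose window
--     [N₁, N₁ + g̃_{N₀}(N₁)] lies in AF_k.  The point N = max(N₀,N₁) works:
--     its window [N, N + g(N)] ⊆ [N, g*(N)] is contained in both windows, and
--     N ≤ Ω because g̃_{Ψ(k,h)} majorizes g̃_{N₀} and Φ⁺ is selfmajorizing.
-- (ii) With M = (Φ⁺⁺)^M(k), every x_m with m ≥ M lies in AF_k; applying Ψ to
--     the shifted counterfunction g_M gives N₀, and N = N₀ + M works since
--     [N, N + g(N)] ⊆ [N₀, N₀ + g_M(N₀)].

open import Defs
open import Data.Nat using (ℕ; zero; suc; _+_; _≤_; _⊔_; _≤′_; ≤′-refl; ≤′-step)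
open import Data.Nat.Properties
open import Data.Product using (_×_; Σ; _,_)
open import Relation.Binary.PropositionalEquality using (cong)
open ≤-Reasoning

∈[]-widen : ∀ {i a a′ b b′} → a ≤ a′ → b′ ≤ b → i ∈[ a′ , b′ ] → i ∈[ a , b ]
∈[]-widen a≤a′ b′≤b (a′≤i , i≤b′) = ≤-trans a≤a′ a′≤i , ≤-trans i≤b′ b′≤b

ᴹ-upper : (f : ℕ → ℕ) (n : ℕ) → f n ≤ (f ᴹ) n
ᴹ-upper f zero    = ≤-refl
ᴹ-upper f (suc n) = m≤n⊔m ((f ᴹ) n) (f (suc n))

ᴹ-mono : (f : ℕ → ℕ) {m n : ℕ} → m ≤ n → (f ᴹ) m ≤ (f ᴹ) n
ᴹ-mono f m≤n = go (≤⇒≤′ m≤n)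
  where
  go : ∀ {m n} → m ≤′ n → (f ᴹ) m ≤ (f ᴹ) n
  go ≤′-refl            = ≤-refl
  go (≤′-step {n} m≤′n) = ≤-trans (go m≤′n) (m≤m⊔n ((f ᴹ) n) (f (suc n)))

gstar-mono : (g : ℕ → ℕ) {m n : ℕ} → m ≤ n → gstar g m ≤ gstar g n
gstar-mono g m≤n = +-mono-≤ m≤n (ᴹ-mono g m≤n)

gstar-covers : (g : ℕ → ℕ) (n : ℕ) → n + g n ≤ gstar g n
gstar-covers g n = +-monoʳ-≤ n (ᴹ-upper g n)

-- Enlarging the base point l of g̃_l yields a majorant, so a selfmajorizing
-- rate may be evaluated at a larger base point.
gtilde-majorizes : (g : ℕ → ℕ) {a b : ℕ} → a ≤ b → gtilde g b ≳ gtilde g a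
gtilde-majorizes g {a} {b} a≤b n n* n≤n* =
  gstar-mono g (⊔-monoʳ-≤ b n≤n*) , gstar-mono g (⊔-mono-≤ a≤b n≤n*)

joint-metastability :
  {X : Set} (Close : ℕ → X → X → Set) (Ft : ℕ → X → Set) (x : ℕ → X)
  (Ψ Φ⁺ : ℕ → (ℕ → ℕ) → ℕ) →
  CauchyMetastabRate Close x Ψ → ARMetastabRate Ft x Φ⁺ → Selfmajorizing Φ⁺ →
  (k : ℕ) (g : ℕ → ℕ) →
  Σ ℕ λ N → (N ≤ Ω k g Ψ Φ⁺) ×
    (∀ i j → i ∈[ N , N + g N ] → j ∈[ N , N + g N ] →
       Close k (x i) (x j) × AF Ft k (x i))
joint-metastability Close Ft x Ψ Φ⁺ Ψ-rate Φ⁺-rate Φ⁺-sm k g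
  with Ψ-rate k (hfun k g Φ⁺)
... | N₀ , N₀≤Ψ , close-on-window
  with Φ⁺-rate k (gtilde g N₀)
... | N₁ , N₁≤Φ⁺ , regular-on-window =
  N₀ ⊔ N₁ , bound , λ i j i∈ j∈ →
    close-on-window i j (inside-Cauchy i∈) (inside-Cauchy j∈) ,
    regular-on-window i (inside-regular i∈)
  where
  N = N₀ ⊔ N₁
  h = hfun k g Φ⁺

  bound : N ≤ Ω k g Ψ Φ⁺
  bound = ⊔-mono-≤ N₀≤Ψ (begin
    N₁                          ≤⟨ N₁≤Φ⁺ ⟩
    Φ⁺ k (gtilde g N₀)          ≤⟨ Σ.proj₂ (Φ⁺-sm k k _ _ ≤-refl
                                     (gtilde-majorizes g N₀≤Ψ)) ⟩
    Φ⁺ k (gtilde g (Ψ k h))     ∎)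

  -- The window at N ends before g*(N), which both rate windows reach.
  inside-Cauchy : ∀ {i} → i ∈[ N , N + g N ] → i ∈[ N₀ , N₀ + h N₀ ]
  inside-Cauchy = ∈[]-widen (m≤m⊔n N₀ N₁) (begin
    N + g N                     ≤⟨ gstar-covers g N ⟩
    gstar g N                   ≤⟨ gstar-mono g (⊔-monoʳ-≤ N₀ N₁≤Φ⁺) ⟩
    h N₀                        ≤⟨ m≤n+m (h N₀) N₀ ⟩
    N₀ + h N₀                   ∎)

  inside-regular : ∀ {i} → i ∈[ N , N + g N ] → i ∈[ N₁ , N₁ + gtilde g N₀ N₁ ]
  inside-regular = ∈[]-widen (m≤n⊔m N₀ N₁) (begin
    N + g N                     ≤⟨ gstar-covers g N ⟩
    gtilde g N₀ N₁              ≤⟨ m≤n+m (gtilde g N₀ N₁) N₁ ⟩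
    N₁ + gtilde g N₀ N₁         ∎)

gsub-covers : (g : ℕ → ℕ) (M N₀ : ℕ) → (N₀ + M) + g (N₀ + M) ≤ N₀ + gsub g M N₀
gsub-covers g M N₀ = begin
  (N₀ + M) + g (N₀ + M)         ≤⟨ +-monoʳ-≤ (N₀ + M) (ᴹ-upper g (N₀ + M)) ⟩
  (N₀ + M) + (g ᴹ) (N₀ + M)     ≡⟨ +-assoc N₀ M _ ⟩
  N₀ + (M + (g ᴹ) (N₀ + M))     ≡⟨ cong (N₀ +_) (+-comm M _) ⟩
  N₀ + gsub g M N₀              ∎

joint-metastability-with-rate :
  {X : Set} (Close : ℕ → X → X → Set) (Ft : ℕ → X → Set) (x : ℕ → X)
  (Ψ : ℕ → (ℕ → ℕ) → ℕ) (Φ⁺⁺ : ℕ → ℕ) →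
  CauchyMetastabRate Close x Ψ → ARRate Ft x Φ⁺⁺ →
  (k : ℕ) (g : ℕ → ℕ) →
  Σ ℕ λ N → (N ≤ Ω̃ k g Ψ (Φ⁺⁺ ᴹ)) ×
    (∀ i j m → i ∈[ N , N + g N ] → j ∈[ N , N + g N ] → N ≤ m →
       Close k (x i) (x j) × AF Ft k (x m))
joint-metastability-with-rate Close Ft x Ψ Φ⁺⁺ Ψ-rate Φ⁺⁺-rate k g
  with Ψ-rate k (gsub g ((Φ⁺⁺ ᴹ) k))
... | N₀ , N₀≤Ψ , close-on-window =
  N₀ + M , +-monoˡ-≤ M N₀≤Ψ , λ i j m i∈ j∈ N≤m →
    close-on-window i j (inside i∈) (inside j∈) ,
    Φ⁺⁺-rate k m (≤-trans (ᴹ-upper Φ⁺⁺ k) (≤-trans (m≤n+m M N₀) N≤m))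
  where
  M = (Φ⁺⁺ ᴹ) k

  inside : ∀ {i} → i ∈[ N₀ + M , (N₀ + M) + g (N₀ + M) ] →
           i ∈[ N₀ , N₀ + gsub g M N₀ ]
  inside = ∈[]-widen (m≤m+n N₀ M) (gsub-covers g M N₀)

theorem5p8 : (X : Set) (Close : ℕ → X → X → Set) (Ft : ℕ → X → Set) →
    Σ X (InF Ft) →
    (x : ℕ → X) → IsCauchy Close x →
    (Ψ : ℕ → (ℕ → ℕ) → ℕ) → CauchyMetastabRate Close x Ψ → Selfmajorizing Ψ →
    (k : ℕ) (g : ℕ → ℕ) →
    ((Φ⁺ : ℕ → (ℕ → ℕ) → ℕ) → AsympReg Ft x → ARMetastabRate Ft x Φ⁺ →
       Selfmajorizing Φ⁺ →
       Σ ℕ λ N → (N ≤ Ω k g Ψ Φ⁺) ×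
         (∀ i j → i ∈[ N , N + g N ] → j ∈[ N , N + g N ] →
            Close k (x i) (x j) × AF Ft k (x i)))
    ×
    ((Φ⁺⁺ : ℕ → ℕ) → AsympReg Ft x → ARRate Ft x Φ⁺⁺ →
       Σ ℕ λ N → (N ≤ Ω̃ k g Ψ (Φ⁺⁺ ᴹ)) ×
         (∀ i j m → i ∈[ N , N + g N ] → j ∈[ N , N + g N ] → N ≤ m →
            Close k (x i) (x j) × AF Ft k (x m)))
theorem5p8 X Close Ft _ x _ Ψ Ψ-rate _ k g =
  (λ Φ⁺ _ Φ⁺-rate Φ⁺-sm →
     joint-metastability Close Ft x Ψ Φ⁺ Ψ-rate Φ⁺-rate Φ⁺-sm k g) ,
  (λ Φ⁺⁺ _ Φ⁺⁺-rate →
     joint-metastability-with-rate Close Ft x Ψ Φ⁺⁺ Ψ-rate Φ⁺⁺-rate k g)
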